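{- Let $p_1\neq p_2$ be primes, $a,b>0$ integers, and $n=p_1^a p_2^b$. Then for every integer $k$ with $1\le k\le n-1$, $\binom{n}{k}$ is divisible by $p_1$ or by $p_2$ (i.e. $n$ satisfies Condition 1 with $p_1$ and $p_2$). -}

module Defs where

module Submission where

-- Put n = p₁ ^ a * p₂ ^ b and 0 < k < n, and suppose that
-- neither p₁ nor p₂ divides C(n,k).  The absorption identity
--     k · C(n,k) = n · C(n-1,k-1)
-- shows n ∣ C(n,k) · k.  A prime power p ^ e is coprime to every number the
-- prime p does not divide, so both p₁ ^ a and p₂ ^ b are coprime to C(n,k);
-- being divisors of n they therefore divide k.  Powers of distinct primes are
-- coprime, so their product n divides k, which is impossible for 0 < k < n.

open import Defs
open import Data.Nat using (ℕ; _^_; _*_; _≤_; _<_; _∸_)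
open import Data.Nat.Primality using (Prime)
open import Data.Nat.Divisibility using (_∣_)
open import Data.Nat.Combinatorics using (_C_)
open import Data.Sum using (_⊎_)
open import Relation.Binary.PropositionalEquality using (_≡_; _≢_)

open import Data.Nat.Base using (zero; suc; _+_; z≤n; s≤s)
open import Data.Nat.Properties
  using (*-comm; *-distribˡ-+; +-assoc; +-identityʳ; *-identityʳ; *-zeroʳ; ≤-trans; <-irrefl)
open import Data.Nat.Divisibility
  using (divides; divides-refl; _∣0; ∣-refl; ∣-trans; *-pres-∣; ∣⇒≤; m∣m*n; n∣m*n; _∣?_)
open import Data.Nat.Primality using (prime⇒irreducible)
open import Data.Nat.Coprimality
  using (Coprime; 1-coprimeTo; coprime-divisor)
  renaming (sym to coprime-sym)
open import Data.Nat.Combinatorics using (nC1≡n; nCk+nC[k+1]≡[n+1]C[k+1])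
open import Data.Nat.Combinatorics.Specification using (k>n⇒nCk≡0)
open import Data.Product using (_,_)
open import Data.Sum using (inj₁; inj₂)
open import Data.Empty using (⊥-elim)
open import Relation.Nullary using (¬_; yes; no)
open import Relation.Binary.PropositionalEquality
  using (refl; sym; trans; cong; cong₂; subst; module ≡-Reasoning)

absorption : ∀ n k → suc k * (suc n C suc k) ≡ suc n * (n C k)
absorption zero zero = refl
absorption zero (suc k)
  rewrite k>n⇒nCk≡0 {1} {suc (suc k)} (s≤s (s≤s z≤n))
        | k>n⇒nCk≡0 {0} {suc k} (s≤s z≤n) = *-zeroʳ (suc (suc k))
absorption (suc m) zero rewrite nC1≡n (suc (suc m)) =
  trans (+-identityʳ (suc (suc m))) (sym (*-identityʳ (suc (suc m))))
absorption (suc m) (suc j) = begin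
  suc (suc j) * (suc (suc m) C suc (suc j))
    ≡⟨ cong (suc (suc j) *_) (sym (nCk+nC[k+1]≡[n+1]C[k+1] (suc m) (suc j))) ⟩
  suc (suc j) * (A + B)
    ≡⟨ *-distribˡ-+ (suc (suc j)) A B ⟩
  (A + suc j * A) + suc (suc j) * B
    ≡⟨ cong₂ (λ u v → (A + u) + v) (absorption m j) (absorption m (suc j)) ⟩
  (A + suc m * X) + suc m * Y
    ≡⟨ +-assoc A (suc m * X) (suc m * Y) ⟩
  A + (suc m * X + suc m * Y)
    ≡⟨ cong (A +_) (sym (*-distribˡ-+ (suc m) X Y)) ⟩
  A + suc m * (X + Y)
    ≡⟨ cong (λ z → A + suc m * z) (nCk+nC[k+1]≡[n+1]C[k+1] m j) ⟩
  suc (suc m) * A ∎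
  where
  open ≡-Reasoning
  A = suc m C suc j
  B = suc m C suc (suc j)
  X = m C j
  Y = m C suc j

n∣nCk*k : ∀ n k → n ∣ (n C k) * k
n∣nCk*k zero    zero    = 0 ∣0
n∣nCk*k zero    (suc k) = 0 ∣0
n∣nCk*k (suc n) zero    = suc n ∣0
n∣nCk*k (suc n) (suc k) =
  divides (n C k) (trans (*-comm (suc n C suc k) (suc k))
                         (trans (absorption n k) (*-comm (suc n) (n C k))))

coprime-to-binomial⇒∣k : ∀ {m n k} → Coprime m (n C k) → m ∣ n → m ∣ k
coprime-to-binomial⇒∣k {n = n} {k} c m∣n = coprime-divisor c (∣-trans m∣n (n∣nCk*k n k))

coprime-* : ∀ {m n c} → Coprime m c → Coprime n c → Coprime (m * n) c
coprime-* {m} cm cn (d∣mn , d∣c) = cn (coprime-divisor d⊥m d∣mn , d∣c)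
  where
  -- every divisor of d divides c, so d is coprime to m
  d⊥m : Coprime _ m
  d⊥m (e∣d , e∣m) = cm (e∣m , ∣-trans e∣d d∣c)

coprime-^ : ∀ {m c} e → Coprime m c → Coprime (m ^ e) c
coprime-^ {c = c} zero    _  = 1-coprimeTo c
coprime-^         (suc e) cm = coprime-* cm (coprime-^ e cm)

coprime-∣⇒*-∣ : ∀ {m n k} → Coprime m n → m ∣ k → n ∣ k → m * n ∣ k
coprime-∣⇒*-∣ {m} {n} c (divides-refl q) n∣qm =
  subst (_∣ q * m) (*-comm n m) (*-pres-∣ n∣q (∣-refl {m}))
  where
  n∣q : n ∣ q
  n∣q = coprime-divisor (coprime-sym c) (subst (n ∣_) (*-comm q m) n∣qm)

prime⇒coprime-to-non-multiple : ∀ {p c} → Prime p → ¬ p ∣ c → Coprime p c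
prime⇒coprime-to-non-multiple pr p∤c (d∣p , d∣c) with prime⇒irreducible pr d∣p
... | inj₁ d≡1  = d≡1
... | inj₂ refl = ⊥-elim (p∤c d∣c)

distinct-primes-∤ : ∀ {p q} → Prime p → Prime q → p ≢ q → ¬ p ∣ q
distinct-primes-∤ pp pq p≢q p∣q with prime⇒irreducible pq p∣q
... | inj₁ refl = ⊥-elim (prime1 pp)
  where
  prime1 : ¬ Prime 1
  prime1 ()
... | inj₂ p≡q  = p≢q p≡q

prime-powers-coprime : ∀ {p q} a b → Prime p → Prime q → p ≢ q → Coprime (p ^ a) (q ^ b)
prime-powers-coprime a b pp pq p≢q =
  coprime-^ a (coprime-sym (coprime-^ b (coprime-sym
    (prime⇒coprime-to-non-multiple pp (distinct-primes-∤ pp pq p≢q)))))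

strictly-between⇒∤ : ∀ {n k} → 1 ≤ k → k ≤ n ∸ 1 → ¬ n ∣ k
strictly-between⇒∤ {zero}  {suc _} _ ()
strictly-between⇒∤ {suc m} {suc _} _ k≤m n∣k = <-irrefl refl (≤-trans (∣⇒≤ n∣k) k≤m)

proposition2p3 : (p₁ p₂ a b : ℕ) → Prime p₁ → Prime p₂ → p₁ ≢ p₂ → 1 ≤ a → 1 ≤ b → (n : ℕ) → n ≡ p₁ ^ a * p₂ ^ b → (k : ℕ) → 1 ≤ k → k ≤ n ∸ 1 → (p₁ ∣ n C k) ⊎ (p₂ ∣ n C k)
proposition2p3 p₁ p₂ a b pr₁ pr₂ p₁≢p₂ _ _ n refl k 1≤k k≤n-1
  with p₁ ∣? (n C k) | p₂ ∣? (n C k)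
... | yes p₁∣C | _        = inj₁ p₁∣C
... | no _     | yes p₂∣C = inj₂ p₂∣C
... | no p₁∤C  | no p₂∤C  = ⊥-elim (strictly-between⇒∤ 1≤k k≤n-1 n∣k)
  where
  p₁^a∣k : p₁ ^ a ∣ k
  p₁^a∣k = coprime-to-binomial⇒∣k
    (coprime-^ a (prime⇒coprime-to-non-multiple pr₁ p₁∤C)) (m∣m*n (p₂ ^ b))
  p₂^b∣k : p₂ ^ b ∣ k
  p₂^b∣k = coprime-to-binomial⇒∣k
    (coprime-^ b (prime⇒coprime-to-non-multiple pr₂ p₂∤C)) (n∣m*n (p₁ ^ a))
  n∣k : n ∣ k
  n∣k = coprime-∣⇒*-∣ (prime-powers-coprime a b pr₁ pr₂ p₁≢p₂) p₁^a∣k p₂^b∣k
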